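{- Let $t\ge 0$ be a threshold, and let $c$ be a threshold-coloring with threshold $t$ of a graph containing a triangle on $\{v_0,v_1,v_2\}$ and a 4-cycle $(u_0,u_1,u_2,u_3,u_0)$, with respect to an edge labeling $l$. (a) If $l(v_0,v_2)=F$, $l(v_0,v_1)=l(v_1,v_2)=N$ and $c(v_0)<c(v_1)$, then $c(v_1)<c(v_2)$. (b) If $l(v_0,v_2)=N$, $l(v_0,v_1)=l(v_1,v_2)=F$ and $c(v_0)<c(v_1)$, then $c(v_2)<c(v_1)$. (c) If $l(u_0,u_3)=l(u_2,u_3)=F$, $l(u_0,u_1)=l(u_1,u_2)=N$ and $c(u_0)<c(u_3)$, then $c(u_1)<c(u_3)$ and $c(u_2)<c(u_3)$. (d) If $l(u_0,u_1)=l(u_2,u_3)=F$, $l(u_0,u_3)=l(u_1,u_2)=N$ and $c(u_0)<c(u_1)$, then $c(u_0)<c(u_2)$, $c(u_3)<c(u_1)$ and $c(u_3)<c(u_2)$. Each statement also holds with every $<$ replaced by $>$.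
   Context: An edge labeling is a map from edges to $\{N,F\}$. A threshold-coloring with respect to $l$ with threshold $t$ is an integer vertex coloring $c$ such that for every edge $(x,y)$, $|c(x)-c(y)|\le t$ iff $l(x,y)=N$. -}

module Defs where

open import Data.Nat using (ℕ; _≤_)
open import Data.Integer using (ℤ; _-_; ∣_∣)
open import Data.Product using (_×_)
open import Relation.Binary.PropositionalEquality using (_≡_)

-- Edge labels: N (near) and F (far).
data Label : Set where
  N F : Label

record Graph : Set₁ where
  field
    V : Set
    E : V → V → Set

open Graph public

EdgeLabeling : Graph → Set
EdgeLabeling G = (x y : V G) → E G x y → Label

IsThresholdColoring : (G : Graph) → EdgeLabeling G → ℕ → (V G → ℤ) → Set
IsThresholdColoring G l t c =
  (x y : V G) (e : E G x y) →
    (∣ c x - c y ∣ ≤ t → l x y e ≡ N) × (l x y e ≡ N → ∣ c x - c y ∣ ≤ t)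

-- Nearness (distance at most t) is convex: if i ≤ j ≤ k and k is near i, then j is near
-- both i and k. Each ordering claim follows by refuting the opposite order, which would put
-- an endpoint of an F-edge between the ends of an N-edge and so make the F-edge near. The
-- claims with > follow by the same argument for the colouring −c, which has the same distances.
module Submission where

open import Defs
open import Data.Nat using (ℕ)
import Data.Nat as ℕ
import Data.Nat.Properties as ℕₚ
open import Data.Integer using (ℤ; _<_; _>_; _≤_; _-_; -_; ∣_∣)
open import Data.Integer.Properties
  using (≤-total; ≤-trans; <⇒≤; ≰⇒>; drop‿+≤+; +-monoˡ-≤; +-monoʳ-≤; neg-mono-≤;
         neg-mono-<; neg-cancel-<; ∣-∣-≤; ∣i-j∣≡∣j-i∣; ∣-i∣≡∣i∣; neg-distrib-+)
open import Data.Product using (_×_; _,_; proj₁; proj₂; map)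
open import Data.Sum using ([_,_])
open import Relation.Nullary using (¬_)
open import Relation.Binary.PropositionalEquality
  using (_≡_; _≢_; sym; trans; cong; subst; subst₂; module ≡-Reasoning)

-- A record rather than a synonym, so that t, a and b can be inferred from a proof.
record Near (t : ℕ) (a b : ℤ) : Set where
  constructor near
  field dist≤ : ∣ a - b ∣ ℕ.≤ t

near-sym : ∀ {t a b} → Near t a b → Near t b a
near-sym {t} {a} {b} (near d) = near (subst (ℕ._≤ t) (∣i-j∣≡∣j-i∣ a b) d)

∣i-j∣≤∣i-k∣ : ∀ {i j k} → i ≤ j → j ≤ k → ∣ i - j ∣ ℕ.≤ ∣ i - k ∣
∣i-j∣≤∣i-k∣ {i} i≤j j≤k = drop‿+≤+
  (subst₂ _≤_ (sym (∣-∣-≤ i≤j)) (sym (∣-∣-≤ (≤-trans i≤j j≤k))) (+-monoˡ-≤ (- i) j≤k))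

∣j-k∣≤∣i-k∣ : ∀ {i j k} → i ≤ j → j ≤ k → ∣ j - k ∣ ℕ.≤ ∣ i - k ∣
∣j-k∣≤∣i-k∣ {k = k} i≤j j≤k = drop‿+≤+
  (subst₂ _≤_ (sym (∣-∣-≤ j≤k)) (sym (∣-∣-≤ (≤-trans i≤j j≤k))) (+-monoʳ-≤ k (neg-mono-≤ i≤j)))

near-shrinkʳ : ∀ {t i j k} → i ≤ j → j ≤ k → Near t i k → Near t i j
near-shrinkʳ i≤j j≤k (near d) = near (ℕₚ.≤-trans (∣i-j∣≤∣i-k∣ i≤j j≤k) d)

near-shrinkˡ : ∀ {t i j k} → i ≤ j → j ≤ k → Near t i k → Near t j k
near-shrinkˡ i≤j j≤k (near d) = near (ℕₚ.≤-trans (∣j-k∣≤∣i-k∣ i≤j j≤k) d)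

∣-i--j∣≡∣i-j∣ : ∀ i j → ∣ - i - - j ∣ ≡ ∣ i - j ∣
∣-i--j∣≡∣i-j∣ i j = begin
  ∣ - i - - j ∣   ≡⟨ cong ∣_∣ (sym (neg-distrib-+ i (- j))) ⟩
  ∣ - (i - j) ∣   ≡⟨ ∣-i∣≡∣i∣ (i - j) ⟩
  ∣ i - j ∣       ∎
  where open ≡-Reasoning

far∧near⇒< : ∀ {t x y z} → x ≤ y → ¬ Near t x y → Near t x z → z < y
far∧near⇒< x≤y far nearˣᶻ = ≰⇒> λ y≤z → far (near-shrinkʳ x≤y y≤z nearˣᶻ)

triangle-NNF⇒< : ∀ {t a b c} → Near t a b → Near t b c → ¬ Near t a c → a < b → b < c
triangle-NNF⇒< {a = a} {c = c} nearᵃᵇ nearᵇᶜ farᵃᶜ a<b = ≰⇒> λ c≤b →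
  [ (λ a≤c → farᵃᶜ (near-shrinkʳ a≤c c≤b nearᵃᵇ))
  , (λ c≤a → farᵃᶜ (near-sym (near-shrinkʳ c≤a (<⇒≤ a<b) (near-sym nearᵇᶜ))))
  ] (≤-total a c)

cycle-NNFF⇒< : ∀ {t u₀ u₁ u₂ u₃} →
  Near t u₀ u₁ → Near t u₁ u₂ → ¬ Near t u₂ u₃ → ¬ Near t u₀ u₃ →
  u₀ < u₃ → u₁ < u₃ × u₂ < u₃
cycle-NNFF⇒< {u₀ = u₀} {u₁} {u₂} {u₃} near₀₁ near₁₂ far₂₃ far₀₃ u₀<u₃ = u₁<u₃ , u₂<u₃
  where
  u₁<u₃ : u₁ < u₃
  u₁<u₃ = far∧near⇒< (<⇒≤ u₀<u₃) far₀₃ near₀₁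
  u₂<u₃ : u₂ < u₃
  u₂<u₃ = ≰⇒> λ u₃≤u₂ → far₂₃ (near-sym (near-shrinkˡ (<⇒≤ u₁<u₃) u₃≤u₂ near₁₂))

cycle-FNFN⇒< : ∀ {t u₀ u₁ u₂ u₃} →
  ¬ Near t u₀ u₁ → Near t u₁ u₂ → ¬ Near t u₂ u₃ → Near t u₀ u₃ →
  u₀ < u₁ → u₀ < u₂ × u₃ < u₁ × u₃ < u₂
cycle-FNFN⇒< {u₀ = u₀} {u₁} {u₂} {u₃} far₀₁ near₁₂ far₂₃ near₀₃ u₀<u₁ = u₀<u₂ , u₃<u₁ , u₃<u₂
  where
  u₀<u₂ : u₀ < u₂
  u₀<u₂ = ≰⇒> λ u₂≤u₀ → far₀₁ (near-shrinkˡ u₂≤u₀ (<⇒≤ u₀<u₁) (near-sym near₁₂))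
  u₃<u₁ : u₃ < u₁
  u₃<u₁ = far∧near⇒< (<⇒≤ u₀<u₁) far₀₁ near₀₃
  u₃<u₂ : u₃ < u₂
  u₃<u₂ = ≰⇒> λ u₂≤u₃ → far₂₃ (near-shrinkˡ (<⇒≤ u₀<u₂) u₂≤u₃ near₀₃)

module _ {G : Graph} {l : EdgeLabeling G} {t : ℕ} {c : V G → ℤ}
         (col : IsThresholdColoring G l t c) where

  N-near : ∀ {x y} (e : E G x y) → l x y e ≡ N → Near t (c x) (c y)
  N-near {x} {y} e isN = near (proj₂ (col x y e) isN)

  F-far : ∀ {x y} (e : E G x y) → l x y e ≡ F → ¬ Near t (c x) (c y)
  F-far {x} {y} e isF (near d) with trans (sym (proj₁ (col x y e) d)) isF
  ... | ()

  neg-isThresholdColoring : IsThresholdColoring G l t (λ v → - c v)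
  neg-isThresholdColoring x y e rewrite ∣-i--j∣≡∣i-j∣ (c x) (c y) = col x y e

mainTheorem8 : (G : Graph) (l : EdgeLabeling G) (t : ℕ) (c : V G → ℤ) →
    IsThresholdColoring G l t c →
    ((v₀ v₁ v₂ : V G) → v₀ ≢ v₁ → v₁ ≢ v₂ → v₀ ≢ v₂ →
      (e₀₁ : E G v₀ v₁) (e₁₂ : E G v₁ v₂) (e₀₂ : E G v₀ v₂) →
      l v₀ v₂ e₀₂ ≡ F → l v₀ v₁ e₀₁ ≡ N → l v₁ v₂ e₁₂ ≡ N →
      (c v₀ < c v₁ → c v₁ < c v₂) × (c v₀ > c v₁ → c v₁ > c v₂))
    ×
    ((v₀ v₁ v₂ : V G) → v₀ ≢ v₁ → v₁ ≢ v₂ → v₀ ≢ v₂ →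
      (e₀₁ : E G v₀ v₁) (e₁₂ : E G v₁ v₂) (e₀₂ : E G v₀ v₂) →
      l v₀ v₂ e₀₂ ≡ N → l v₀ v₁ e₀₁ ≡ F → l v₁ v₂ e₁₂ ≡ F →
      (c v₀ < c v₁ → c v₂ < c v₁) × (c v₀ > c v₁ → c v₂ > c v₁))
    ×
    ((u₀ u₁ u₂ u₃ : V G) →
      u₀ ≢ u₁ → u₀ ≢ u₂ → u₀ ≢ u₃ → u₁ ≢ u₂ → u₁ ≢ u₃ → u₂ ≢ u₃ →
      (e₀₁ : E G u₀ u₁) (e₁₂ : E G u₁ u₂) (e₂₃ : E G u₂ u₃) (e₀₃ : E G u₀ u₃) →
      l u₀ u₃ e₀₃ ≡ F → l u₂ u₃ e₂₃ ≡ F → l u₀ u₁ e₀₁ ≡ N → l u₁ u₂ e₁₂ ≡ N →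
      (c u₀ < c u₃ → c u₁ < c u₃ × c u₂ < c u₃) ×
      (c u₀ > c u₃ → c u₁ > c u₃ × c u₂ > c u₃))
    ×
    ((u₀ u₁ u₂ u₃ : V G) →
      u₀ ≢ u₁ → u₀ ≢ u₂ → u₀ ≢ u₃ → u₁ ≢ u₂ → u₁ ≢ u₃ → u₂ ≢ u₃ →
      (e₀₁ : E G u₀ u₁) (e₁₂ : E G u₁ u₂) (e₂₃ : E G u₂ u₃) (e₀₃ : E G u₀ u₃) →
      l u₀ u₁ e₀₁ ≡ F → l u₂ u₃ e₂₃ ≡ F → l u₀ u₃ e₀₃ ≡ N → l u₁ u₂ e₁₂ ≡ N →
      (c u₀ < c u₁ → c u₀ < c u₂ × c u₃ < c u₁ × c u₃ < c u₂) ×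
      (c u₀ > c u₁ → c u₀ > c u₂ × c u₃ > c u₁ × c u₃ > c u₂))
mainTheorem8 G l t c col =
  (λ _ _ _ _ _ _ e₀₁ e₁₂ e₀₂ F₀₂ N₀₁ N₁₂ →
    triangle-NNF⇒< (N-near col e₀₁ N₀₁) (N-near col e₁₂ N₁₂) (F-far col e₀₂ F₀₂) ,
    λ p → neg-cancel-< (triangle-NNF⇒< (N-near col⁻ e₀₁ N₀₁) (N-near col⁻ e₁₂ N₁₂)
                                        (F-far col⁻ e₀₂ F₀₂) (neg-mono-< p))) ,
  -- part (b) does not need l(v₁,v₂) = F
  (λ _ _ _ _ _ _ e₀₁ _ e₀₂ N₀₂ F₀₁ _ →
    (λ p → far∧near⇒< (<⇒≤ p) (F-far col e₀₁ F₀₁) (N-near col e₀₂ N₀₂)) ,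
    λ p → neg-cancel-< (far∧near⇒< (<⇒≤ (neg-mono-< p)) (F-far col⁻ e₀₁ F₀₁) (N-near col⁻ e₀₂ N₀₂))) ,
  (λ _ _ _ _ _ _ _ _ _ _ e₀₁ e₁₂ e₂₃ e₀₃ F₀₃ F₂₃ N₀₁ N₁₂ →
    cycle-NNFF⇒< (N-near col e₀₁ N₀₁) (N-near col e₁₂ N₁₂) (F-far col e₂₃ F₂₃) (F-far col e₀₃ F₀₃) ,
    λ p → map neg-cancel-< neg-cancel-<
      (cycle-NNFF⇒< (N-near col⁻ e₀₁ N₀₁) (N-near col⁻ e₁₂ N₁₂)
                    (F-far col⁻ e₂₃ F₂₃) (F-far col⁻ e₀₃ F₀₃) (neg-mono-< p))) ,
  (λ _ _ _ _ _ _ _ _ _ _ e₀₁ e₁₂ e₂₃ e₀₃ F₀₁ F₂₃ N₀₃ N₁₂ →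
    cycle-FNFN⇒< (F-far col e₀₁ F₀₁) (N-near col e₁₂ N₁₂) (F-far col e₂₃ F₂₃) (N-near col e₀₃ N₀₃) ,
    λ p → map neg-cancel-< (map neg-cancel-< neg-cancel-<)
      (cycle-FNFN⇒< (F-far col⁻ e₀₁ F₀₁) (N-near col⁻ e₁₂ N₁₂)
                    (F-far col⁻ e₂₃ F₂₃) (N-near col⁻ e₀₃ N₀₃) (neg-mono-< p)))
  where
  col⁻ : IsThresholdColoring G l t (λ v → - c v)
  col⁻ = neg-isThresholdColoring {c = c} col
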